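{- For every $\varepsilon>0$ there exist infinitely many pairs $(N,\mathbf{v})$, where $N$ is a positive integer and $\mathbf{v}=(a,b,c)$ is a triple of integers with $0<a<b<c<N$ and $\gcd(N,a)=1$, such that $$\frac{\lambda^{\ast}(\Pi_{N,\mathbf{v}})}{N^{2/3}} > 2^{1/6}-\varepsilon.$$
   Context: For integers $N,a,b,c$ with $0<a<b<c<N$ and $\gcd(N,a)=1$, write $\mathbf{v}=(a,b,c)$ and define the point set $$\Pi_{N,\mathbf{v}}=\{(na \bmod N,\ nb \bmod N,\ nc \bmod N): 0\le n<N\}\subset[0,N-1]^3,$$ where $x \bmod N$ denotes the least nonnegative residue of $x$ modulo $N$. Define the shortest distance $$\lambda^{\ast}(\Pi_{N,\mathbf{v}})=\min_{\mathbf{x}\neq\mathbf{y},\ \mathbf{x},\mathbf{y}\in\Pi_{N,\mathbf{v}}}\|\mathbf{x}-\mathbf{y}\|,$$ with $\|\cdot\|$ the Euclidean norm.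
   Formalization: The parameter ε ranges over the positive rationals. -}

module Defs where

open import Data.Nat using (ℕ; zero; suc; _+_; _*_; _⊓_; ∣_-_∣)
open import Data.Nat.DivMod using (_%_)
open import Data.Nat.Properties using (_≟_)
open import Data.List using (List; []; _∷_; upTo; map; concatMap)
open import Data.Maybe using (Maybe; just; nothing)
open import Data.Product using (_×_; _,_)
open import Data.Product.Properties using (≡-dec)
open import Relation.Nullary using (yes; no)
open import Relation.Binary.Definitions using (DecidableEquality)

Point : Set
Point = ℕ × ℕ × ℕ

_≟P_ : DecidableEquality Point
_≟P_ = ≡-dec _≟_ (≡-dec _≟_ _≟_)

-- least nonnegative residue modulo N (only used with N > 0;
-- the N = 0 clause is an irrelevant default)
_mod_ : ℕ → ℕ → ℕ
x mod zero = x
x mod suc k = x % suc k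

pt : ℕ → ℕ → ℕ → ℕ → ℕ → Point
pt N a b c n = ((n * a) mod N , (n * b) mod N , (n * c) mod N)

Π : ℕ → ℕ → ℕ → ℕ → List Point
Π N a b c = map (pt N a b c) (upTo N)

sqDist : Point → Point → ℕ
sqDist (x₁ , y₁ , z₁) (x₂ , y₂ , z₂) =
  ∣ x₁ - x₂ ∣ * ∣ x₁ - x₂ ∣ + ∣ y₁ - y₂ ∣ * ∣ y₁ - y₂ ∣ + ∣ z₁ - z₂ ∣ * ∣ z₁ - z₂ ∣

distsFrom : Point → List Point → List ℕ
distsFrom x [] = []
distsFrom x (y ∷ ys) with x ≟P y
... | yes _ = distsFrom x ys
... | no  _ = sqDist x y ∷ distsFrom x ys

minList : List ℕ → Maybe ℕ
minList [] = nothing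
minList (x ∷ xs) with minList xs
... | nothing = just x
... | just m  = just (x ⊓ m)

-- shortestSq N a b c = just (λ*(Π_{N,v}))^2 : the minimum of ‖x - y‖² over x ≠ y in Π_{N,v}
shortestSq : ℕ → ℕ → ℕ → ℕ → Maybe ℕ
shortestSq N a b c = minList (concatMap (λ x → distsFrom x (Π N a b c)) (Π N a b c))

module Submission where

-- For k ≥ 0 put K = k + 1 and consider the explicit family
--   N = K(4K² + 3),   v = (1, b, c) = (1, 2K² − K + 1, 2K² + K + 1).
-- The difference of two points of Π_{N,v} is a vector e = d·v + N·(l, μ, ν) of the lattice
-- ℤv + Nℤ³.  A polynomial identity (lattice-identity) shows
--   K‖e‖² = N(K²·T(x, y, z) + z²),   T = x² + (x − y)² + (y − z)² + z²,
-- for integer linear forms x, y, z of (d, l, μ, ν).  Since T is even and T ≥ z², any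
-- nonzero e has ‖e‖² ≥ 2KN (module Lattice), so λ*² ≥ 2KN ≈ 2^{1/3} N^{4/3}.  Finally, for ε = e/f we take q = f + 1 and the
-- largest p with p⁶ < 2q⁶, so that p/q < 2^{1/6} ≤ (p + 1)/q < p/q + ε, and choose K so
-- large that p⁶N⁴ < (2KN)³q⁶ and N exceeds every modulus of the excluded list.

module Lattice where
  open import Data.Nat as ℕ using (ℕ; zero; suc; NonZero; _≤_; z≤n; ∣_-_∣)
  import Data.Nat.Properties as ℕₚ
  open import Data.Nat.DivMod using (_%_; _/_; m≡m%n+[m/n]*n)
  open import Data.Integer as ℤ using (ℤ; +_; -[1+_]; _+_; _*_; _-_)
  open import Data.Integer.Properties using (pos-*; +-injective)
  open import Data.Integer.Tactic.RingSolver using (solve-∀)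
  open import Data.Product using (∃; _,_; proj₁; proj₂)
  open import Data.Sum using (inj₁; inj₂)
  open import Data.Empty using (⊥-elim)
  open import Function using (_∘_)
  open import Relation.Binary.PropositionalEquality
    using (_≡_; _≢_; refl; sym; trans; cong; cong₂; module ≡-Reasoning)
  open import Defs using (Point; pt; sqDist)

  -- The family, indexed by k with K = k + 1.  The definitions are arranged so that
  -- 1 < b < c < N is visible from their shape.
  K : ℕ → ℕ
  K k = suc k

  bₖ cₖ Nₖ : ℕ → ℕ
  bₖ k = suc (K k ℕ.* suc (2 ℕ.* k))
  cₖ k = bₖ k ℕ.+ 2 ℕ.* K k
  Nₖ k = cₖ k ℕ.+ suc (2 ℕ.* k) ℕ.* suc (2 ℕ.* (K k ℕ.* K k))

  bℤ cℤ Nℤ : ℤ → ℤ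
  bℤ κ = + 2 * κ * κ - κ + + 1
  cℤ κ = + 2 * κ * κ + κ + + 1
  Nℤ κ = κ * (+ 4 * κ * κ + + 3)

  cast-b : ∀ k → + bₖ k ≡ bℤ (+ K k)
  cast-b k = trans (cong (λ t → + 1 + t) product) (poly (+ k))
    where
    product : + (K k ℕ.* suc (2 ℕ.* k)) ≡ + K k * (+ 1 + + 2 * + k)
    product = trans (pos-* (K k) (suc (2 ℕ.* k))) (cong (λ t → + K k * (+ 1 + t)) (pos-* 2 k))
    poly : ∀ j → + 1 + (+ 1 + j) * (+ 1 + + 2 * j) ≡ + 2 * (+ 1 + j) * (+ 1 + j) - (+ 1 + j) + + 1
    poly = solve-∀

  cast-c : ∀ k → + cₖ k ≡ cℤ (+ K k)
  cast-c k = trans (cong₂ _+_ (cast-b k) (pos-* 2 (K k))) (poly (+ K k))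
    where
    poly : ∀ κ → (+ 2 * κ * κ - κ + + 1) + + 2 * κ ≡ + 2 * κ * κ + κ + + 1
    poly = solve-∀

  cast-N : ∀ k → + Nₖ k ≡ Nℤ (+ K k)
  cast-N k = trans (cong₂ _+_ (cast-c k) (trans (pos-* (suc (2 ℕ.* k)) _) odd-factors)) (poly (+ k))
    where
    odd-factors : + suc (2 ℕ.* k) * + suc (2 ℕ.* (K k ℕ.* K k))
                ≡ (+ 1 + + 2 * + k) * (+ 1 + + 2 * (+ K k * + K k))
    odd-factors = cong₂ (λ s t → (+ 1 + s) * (+ 1 + t)) (pos-* 2 k)
                        (trans (pos-* 2 (K k ℕ.* K k)) (cong (+ 2 *_) (pos-* (K k) (K k))))
    poly : ∀ j → (+ 2 * (+ 1 + j) * (+ 1 + j) + (+ 1 + j) + + 1)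
                   + (+ 1 + + 2 * j) * (+ 1 + + 2 * ((+ 1 + j) * (+ 1 + j)))
                 ≡ (+ 1 + j) * (+ 4 * (+ 1 + j) * (+ 1 + j) + + 3)
    poly = solve-∀

  -- The central identity: for e = d(1, b, c) + N(l, μ, ν),
  --   K‖e‖² = N(K²·T(x, y, z) + z²)   with T(x, y, z) = x² + (x − y)² + (y − z)² + z².
  -- (b, c, N are bℤ κ, cℤ κ, Nℤ κ written out, so that the ring solver sees polynomials.)
  lattice-identity : ∀ κ d l μ ν →
    let b = + 2 * κ * κ - κ + + 1
        c = + 2 * κ * κ + κ + + 1
        N = κ * (+ 4 * κ * κ + + 3)
        x = (κ + + 1) * l - κ * μ + (κ - + 1) * ν
        y = + 2 * κ * l + μ - ν
        z = d + κ * (l + μ + ν)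
        e₁ = d * + 1 + l * N
        e₂ = d * b + μ * N
        e₃ = d * c + ν * N
    in κ * (e₁ * e₁ + e₂ * e₂ + e₃ * e₃)
       ≡ N * (κ * κ * (x * x + (x - y) * (x - y) + (y - z) * (y - z) + z * z) + z * z)
  lattice-identity = solve-∀

  sqℕ : ℤ → ℕ
  sqℕ i = ℤ.∣ i ∣ ℕ.* ℤ.∣ i ∣

  sq-abs : ∀ i → + sqℕ i ≡ i * i
  sq-abs (+ n)    = pos-* n n
  sq-abs -[1+ n ] = refl

  sq-diff : ∀ a b → + (∣ a - b ∣ ℕ.* ∣ a - b ∣) ≡ (+ a - + b) * (+ a - + b)
  sq-diff zero    b       = trans (pos-* b b) (negate (+ b))
    where
    negate : ∀ β → β * β ≡ (+ 0 - β) * (+ 0 - β)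
    negate = solve-∀
  sq-diff (suc a) zero    = trans (pos-* (suc a) (suc a)) (minus-zero (+ suc a))
    where
    minus-zero : ∀ α → α * α ≡ (α - + 0) * (α - + 0)
    minus-zero = solve-∀
  sq-diff (suc a) (suc b) = trans (sq-diff a b) (cong (λ t → t * t) (shift (+ a) (+ b)))
    where
    shift : ∀ α β → α - β ≡ (+ 1 + α) - (+ 1 + β)
    shift = solve-∀

  sqDist-ℤ : ∀ x₁ y₁ z₁ x₂ y₂ z₂ →
    + sqDist (x₁ , y₁ , z₁) (x₂ , y₂ , z₂)
      ≡ (+ x₁ - + x₂) * (+ x₁ - + x₂) + (+ y₁ - + y₂) * (+ y₁ - + y₂) + (+ z₁ - + z₂) * (+ z₁ - + z₂)
  sqDist-ℤ x₁ y₁ z₁ x₂ y₂ z₂ =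
    cong₂ _+_ (cong₂ _+_ (sq-diff x₁ x₂) (sq-diff y₁ y₂)) (sq-diff z₁ z₂)

  sqDist-zero : ∀ p q → sqDist p q ≡ 0 → p ≡ q
  sqDist-zero (x₁ , y₁ , z₁) (x₂ , y₂ , z₂) s≡0 =
    cong₂ _,_ (sq-zero x₁ x₂ X≡0) (cong₂ _,_ (sq-zero y₁ y₂ Y≡0) (sq-zero z₁ z₂ Z≡0))
    where
    sq-zero : ∀ a b → ∣ a - b ∣ ℕ.* ∣ a - b ∣ ≡ 0 → a ≡ b
    sq-zero a b sq≡0 with ℕₚ.m*n≡0⇒m≡0∨n≡0 ∣ a - b ∣ sq≡0
    ... | inj₁ d≡0 = ℕₚ.∣m-n∣≡0⇒m≡n d≡0
    ... | inj₂ d≡0 = ℕₚ.∣m-n∣≡0⇒m≡n d≡0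
    X Y Z : ℕ
    X = ∣ x₁ - x₂ ∣ ℕ.* ∣ x₁ - x₂ ∣
    Y = ∣ y₁ - y₂ ∣ ℕ.* ∣ y₁ - y₂ ∣
    Z = ∣ z₁ - z₂ ∣ ℕ.* ∣ z₁ - z₂ ∣
    X+Y≡0 : X ℕ.+ Y ≡ 0
    X+Y≡0 = ℕₚ.m+n≡0⇒m≡0 (X ℕ.+ Y) s≡0
    X≡0 : X ≡ 0
    X≡0 = ℕₚ.m+n≡0⇒m≡0 X X+Y≡0
    Y≡0 : Y ≡ 0
    Y≡0 = ℕₚ.m+n≡0⇒n≡0 X X+Y≡0
    Z≡0 : Z ≡ 0
    Z≡0 = ℕₚ.m+n≡0⇒n≡0 (X ℕ.+ Y) s≡0

  residue-ℤ : ∀ x N .{{_ : NonZero N}} → + (x % N) ≡ + x - + (x / N) * + N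
  residue-ℤ x N = begin
    + (x % N)                                        ≡⟨ cancel (+ (x % N)) (+ (x / N) * + N) ⟩
    (+ (x % N) + + (x / N) * + N) - + (x / N) * + N  ≡⟨ cong (λ t → (+ (x % N) + t) - + (x / N) * + N)
                                                              (pos-* (x / N) N) ⟨
    + (x % N ℕ.+ x / N ℕ.* N) - + (x / N) * + N      ≡⟨ cong (λ t → + t - + (x / N) * + N)
                                                              (m≡m%n+[m/n]*n x N) ⟨
    + x - + (x / N) * + N                            ∎
    where
    open ≡-Reasoning
    cancel : ∀ α β → α ≡ (α + β) - β
    cancel = solve-∀

  residue-diff : ∀ N a n m .{{_ : NonZero N}} →
    + ((n ℕ.* a) % N) - + ((m ℕ.* a) % N)
      ≡ (+ n - + m) * + a + (+ ((m ℕ.* a) / N) - + ((n ℕ.* a) / N)) * + N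
  residue-diff N a n m = begin
    + ((n ℕ.* a) % N) - + ((m ℕ.* a) % N)
      ≡⟨ cong₂ _-_ (residue-ℤ (n ℕ.* a) N) (residue-ℤ (m ℕ.* a) N) ⟩
    (+ (n ℕ.* a) - qₙ * + N) - (+ (m ℕ.* a) - qₘ * + N)
      ≡⟨ cong₂ (λ s t → (s - qₙ * + N) - (t - qₘ * + N)) (pos-* n a) (pos-* m a) ⟩
    (+ n * + a - qₙ * + N) - (+ m * + a - qₘ * + N)
      ≡⟨ regroup (+ n) (+ m) (+ a) qₙ qₘ (+ N) ⟩
    (+ n - + m) * + a + (qₘ - qₙ) * + N
      ∎
    where
    open ≡-Reasoning
    qₙ qₘ : ℤ
    qₙ = + ((n ℕ.* a) / N)
    qₘ = + ((m ℕ.* a) / N)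
    regroup : ∀ α β γ δ ε ζ → (α * γ - δ * ζ) - (β * γ - ε * ζ) ≡ (α - β) * γ + (ε - δ) * ζ
    regroup = solve-∀

  halve : ∀ W (τ : ℤ) → + W ≡ + 2 * τ → ∃ λ t → W ≡ 2 ℕ.* t
  halve W (+ t) W≡2t = t , +-injective (trans W≡2t (sym (pos-* 2 t)))
  halve W -[1+ t ] ()

  form : ℤ → ℤ → ℤ → ℕ
  form x y z = sqℕ x ℕ.+ sqℕ (x - y) ℕ.+ sqℕ (y - z) ℕ.+ sqℕ z

  form-ℤ : ∀ x y z → + form x y z ≡ x * x + (x - y) * (x - y) + (y - z) * (y - z) + z * z
  form-ℤ x y z = cong₂ _+_ (cong₂ _+_ (cong₂ _+_ (sq-abs x) (sq-abs (x - y))) (sq-abs (y - z))) (sq-abs z)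

  form-even : ∀ x y z → ∃ λ t → form x y z ≡ 2 ℕ.* t
  form-even x y z = halve (form x y z) _ (trans (form-ℤ x y z) (double x y z))
    where
    double : ∀ x y z → x * x + (x - y) * (x - y) + (y - z) * (y - z) + z * z
                     ≡ + 2 * (x * x - x * y + y * y - y * z + z * z)
    double = solve-∀

  -- Cancellation step: K s = N(K²T + z²) with z² ≤ T, T even and s ≠ 0 forces s ≥ 2KN
  -- (T = 0 would give z = 0 and s = 0, so T ≥ 2).
  norm-gap : ∀ k N s T z² → suc k ℕ.* s ≡ N ℕ.* (suc k ℕ.* suc k ℕ.* T ℕ.+ z²) →
             z² ≤ T → (∃ λ t → T ≡ 2 ℕ.* t) → s ≢ 0 → 2 ℕ.* suc k ℕ.* N ≤ s
  norm-gap k N s T z² eq z²≤T (zero , refl) s≢0 = ⊥-elim (s≢0 (ℕₚ.m*n≡0⇒m≡0 s (suc k) s·K≡0))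
    where
    open ≡-Reasoning
    s·K≡0 : s ℕ.* suc k ≡ 0
    s·K≡0 = begin
      s ℕ.* suc k                            ≡⟨ ℕₚ.*-comm s (suc k) ⟩
      suc k ℕ.* s                            ≡⟨ eq ⟩
      N ℕ.* (suc k ℕ.* suc k ℕ.* 0 ℕ.+ z²)   ≡⟨ cong (λ t → N ℕ.* (t ℕ.+ z²)) (ℕₚ.*-zeroʳ (suc k ℕ.* suc k)) ⟩
      N ℕ.* z²                               ≡⟨ cong (N ℕ.*_) (ℕₚ.n≤0⇒n≡0 z²≤T) ⟩
      N ℕ.* 0                                ≡⟨ ℕₚ.*-zeroʳ N ⟩
      0                                      ∎
  norm-gap k N s T z² eq z²≤T (suc t , refl) s≢0 = ℕₚ.*-cancelˡ-≤ (suc k) (begin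
    suc k ℕ.* (2 ℕ.* suc k ℕ.* N)                    ≡⟨ reorder (suc k) N ⟩
    N ℕ.* (suc k ℕ.* suc k ℕ.* 2)                    ≤⟨ ℕₚ.*-monoʳ-≤ N (ℕₚ.*-monoʳ-≤ (suc k ℕ.* suc k) 2≤T) ⟩
    N ℕ.* (suc k ℕ.* suc k ℕ.* T)                    ≤⟨ ℕₚ.*-monoʳ-≤ N (ℕₚ.m≤m+n _ z²) ⟩
    N ℕ.* (suc k ℕ.* suc k ℕ.* T ℕ.+ z²)             ≡⟨ eq ⟨
    suc k ℕ.* s                                       ∎)
    where
    open ℕₚ.≤-Reasoning
    import Data.Nat.Tactic.RingSolver as ℕ-Solver
    2≤T : 2 ≤ 2 ℕ.* suc t
    2≤T = ℕₚ.*-monoʳ-≤ 2 (ℕ.s≤s z≤n)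
    reorder : ∀ κ N → κ ℕ.* (2 ℕ.* κ ℕ.* N) ≡ N ℕ.* (κ ℕ.* κ ℕ.* 2)
    reorder = ℕ-Solver.solve-∀

  lattice-bound : ∀ k s (d l μ ν : ℤ) →
    let e₁ = d * + 1 + l * + Nₖ k
        e₂ = d * + bₖ k + μ * + Nₖ k
        e₃ = d * + cₖ k + ν * + Nₖ k
    in + s ≡ e₁ * e₁ + e₂ * e₂ + e₃ * e₃ → s ≢ 0 → 2 ℕ.* K k ℕ.* Nₖ k ≤ s
  lattice-bound k s d l μ ν norm s≢0 =
    norm-gap k (Nₖ k) s (form x y z) (sqℕ z) scaled z²≤T (form-even x y z) s≢0
    where
    open ≡-Reasoning
    κ x y z : ℤ
    κ = + K k
    x = (κ + + 1) * l - κ * μ + (κ - + 1) * ν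
    y = + 2 * κ * l + μ - ν
    z = d + κ * (l + μ + ν)
    ‖_,_,_‖ : ℤ → ℤ → ℤ → ℤ
    ‖ b , c , N ‖ = (d * + 1 + l * N) * (d * + 1 + l * N) + (d * b + μ * N) * (d * b + μ * N)
                    + (d * c + ν * N) * (d * c + ν * N)
    lhs : + (K k ℕ.* s) ≡ κ * ‖ bℤ κ , cℤ κ , Nℤ κ ‖
    lhs = begin
      + (K k ℕ.* s)                     ≡⟨ pos-* (K k) s ⟩
      κ * + s                           ≡⟨ cong (κ *_) norm ⟩
      κ * ‖ + bₖ k , + cₖ k , + Nₖ k ‖  ≡⟨ cong₂ (λ b cN → κ * ‖ b , proj₁ cN , proj₂ cN ‖)
                                                 (cast-b k) (cong₂ _,_ (cast-c k) (cast-N k)) ⟩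
      κ * ‖ bℤ κ , cℤ κ , Nℤ κ ‖        ∎
    rhs : + (Nₖ k ℕ.* (K k ℕ.* K k ℕ.* form x y z ℕ.+ sqℕ z))
          ≡ Nℤ κ * (κ * κ * (x * x + (x - y) * (x - y) + (y - z) * (y - z) + z * z) + z * z)
    rhs = begin
      + (Nₖ k ℕ.* (K k ℕ.* K k ℕ.* form x y z ℕ.+ sqℕ z))
        ≡⟨ pos-* (Nₖ k) (K k ℕ.* K k ℕ.* form x y z ℕ.+ sqℕ z) ⟩
      + Nₖ k * (+ (K k ℕ.* K k ℕ.* form x y z) + + sqℕ z)
        ≡⟨ cong₂ (λ u v → u * (v + + sqℕ z)) (cast-N k)
                 (trans (pos-* (K k ℕ.* K k) (form x y z)) (cong₂ _*_ (pos-* (K k) (K k)) (form-ℤ x y z))) ⟩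
      Nℤ κ * (κ * κ * (x * x + (x - y) * (x - y) + (y - z) * (y - z) + z * z) + + sqℕ z)
        ≡⟨ cong (λ v → Nℤ κ * (κ * κ * (x * x + (x - y) * (x - y) + (y - z) * (y - z) + z * z) + v)) (sq-abs z) ⟩
      Nℤ κ * (κ * κ * (x * x + (x - y) * (x - y) + (y - z) * (y - z) + z * z) + z * z)
        ∎
    scaled : K k ℕ.* s ≡ Nₖ k ℕ.* (K k ℕ.* K k ℕ.* form x y z ℕ.+ sqℕ z)
    scaled = +-injective (trans lhs (trans (lattice-identity κ d l μ ν) (sym rhs)))
    z²≤T : sqℕ z ≤ form x y z
    z²≤T = ℕₚ.m≤n+m (sqℕ z) (sqℕ x ℕ.+ sqℕ (x - y) ℕ.+ sqℕ (y - z))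

  separation : ∀ k n m → let P = pt (Nₖ k) 1 (bₖ k) (cₖ k) in
               P n ≢ P m → 2 ℕ.* K k ℕ.* Nₖ k ≤ sqDist (P n) (P m)
  separation k n m Pn≢Pm =
    lattice-bound k (sqDist (P n) (P m)) (+ n - + m) (offset 1) (offset (bₖ k)) (offset (cₖ k))
                  norm (Pn≢Pm ∘ sqDist-zero (P n) (P m))
    where
    N : ℕ
    N = Nₖ k
    P : ℕ → Point
    P = pt N 1 (bₖ k) (cₖ k)
    -- the lattice coordinates (l, μ, ν) of the difference P n − P m
    offset : ℕ → ℤ
    offset a = + ((m ℕ.* a) / N) - + ((n ℕ.* a) / N)
    -- the coordinates of P i; mod N is % N since N is a successor
    residue : ℕ → ℕ → ℕ
    residue a i = (i ℕ.* a) % N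
    squared : ∀ {α β} → α ≡ β → α * α ≡ β * β
    squared = cong (λ t → t * t)
    norm : + sqDist (P n) (P m)
           ≡ ((+ n - + m) * + 1 + offset 1 * + N) * ((+ n - + m) * + 1 + offset 1 * + N)
             + ((+ n - + m) * + bₖ k + offset (bₖ k) * + N) * ((+ n - + m) * + bₖ k + offset (bₖ k) * + N)
             + ((+ n - + m) * + cₖ k + offset (cₖ k) * + N) * ((+ n - + m) * + cₖ k + offset (cₖ k) * + N)
    norm = trans (sqDist-ℤ (residue 1 n) (residue (bₖ k) n) (residue (cₖ k) n)
                           (residue 1 m) (residue (bₖ k) m) (residue (cₖ k) m))
                 (cong₂ _+_ (cong₂ _+_ (squared (residue-diff N 1 n m))
                                       (squared (residue-diff N (bₖ k) n m)))
                            (squared (residue-diff N (cₖ k) n m)))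

open import Defs
open import Data.Nat using (ℕ; _+_; _*_; _^_; _<_)
open import Data.Nat.GCD using (gcd)
open import Data.List using (List)
open import Data.List.Membership.Propositional using (_∉_)
open import Data.Maybe using (just)
open import Data.Product using (_×_; _,_; ∃)
open import Relation.Binary.PropositionalEquality using (_≡_)

open import Data.Nat using (zero; suc; NonZero; >-nonZero; _≤_; _⊓_; z≤n; s≤s; _<?_)
open import Data.Nat.Properties
  using (≤-trans; ≤-<-trans; <⇒≱; ≮⇒≥; ⊓-glb; +-comm; *-assoc; m≤m+n; m≤n+m; m<m+n; m≤m*n; m≤n*m;
         +-monoʳ-≤; +-monoʳ-<; +-cancelʳ-<; *-monoˡ-≤; *-monoʳ-≤; *-monoˡ-<; ^-monoˡ-≤; ^-monoˡ-<;
         m^n≢0; module ≤-Reasoning)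
open import Data.Nat.ListAction using (sum)
open import Data.Nat.GCD using (gcd-zeroʳ)
open import Data.Nat.Tactic.RingSolver using (solve-∀)
open import Data.List using ([]; _∷_; map; concatMap)
open import Data.List.Relation.Unary.All using (All; []; _∷_)
open import Data.List.Relation.Unary.All.Properties using (concat⁺; map⁺; applyUpTo⁺₂)
open import Data.List.Membership.Propositional using (_∈_)
open import Data.List.Relation.Unary.Any using (here; there)
open import Data.Empty using (⊥-elim)
open import Data.Product using (proj₁)
open import Function using (id)
open import Relation.Nullary using (yes; no)
open import Relation.Binary.PropositionalEquality using (_≢_; refl; sym; cong; subst; module ≡-Reasoning)
open Lattice using (K; bₖ; cₖ; Nₖ; separation)

distances : ℕ → ℕ → ℕ → ℕ → List ℕ
distances N a b c = concatMap (λ x → distsFrom x (Π N a b c)) (Π N a b c)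

distsFrom-lower : ∀ {B} x ys → All (λ y → x ≢ y → B ≤ sqDist x y) ys → All (B ≤_) (distsFrom x ys)
distsFrom-lower x []       []         = []
distsFrom-lower x (y ∷ ys) (h ∷ hs) with x ≟P y
... | yes _   = distsFrom-lower x ys hs
... | no x≢y  = h x≢y ∷ distsFrom-lower x ys hs

distances-lower : ∀ N a b c B →
  (∀ n m → pt N a b c n ≢ pt N a b c m → B ≤ sqDist (pt N a b c n) (pt N a b c m)) →
  All (B ≤_) (distances N a b c)
distances-lower N a b c B sep =
  concat⁺ (map⁺ (every-point (λ n → distsFrom-lower (pt N a b c n) (Π N a b c) (every-point (sep n)))))
  where
  every-point : ∀ {P : Point → Set} → (∀ n → P (pt N a b c n)) → All P (Π N a b c)
  every-point h = map⁺ (applyUpTo⁺₂ id N h)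

minList-lower : ∀ {B} xs → All (B ≤_) xs → (∃ λ y → ∃ λ ws → xs ≡ y ∷ ws) →
                ∃ λ D → minList xs ≡ just D × B ≤ D
minList-lower (x ∷ [])     (B≤x ∷ [])    _ = x , refl , B≤x
minList-lower (x ∷ y ∷ ys) (B≤x ∷ B≤ys) _ with minList-lower (y ∷ ys) B≤ys (y , ys , refl)
... | D , eq , B≤D rewrite eq = x ⊓ D , refl , ⊓-glb B≤x B≤D

-- For the family, the first two points 0 and (1, b, c) differ, so the list of distances
-- computes to a nonempty list.
family-nonempty : ∀ k → ∃ λ y → ∃ λ ws → distances (Nₖ k) 1 (bₖ k) (cₖ k) ≡ y ∷ ws
family-nonempty k = _ , _ , refl

family-shortest : ∀ k → ∃ λ D → shortestSq (Nₖ k) 1 (bₖ k) (cₖ k) ≡ just D × 2 * K k * Nₖ k ≤ D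
family-shortest k =
  minList-lower _ (distances-lower (Nₖ k) 1 (bₖ k) (cₖ k) _ (separation k)) (family-nonempty k)

modulus-closed : ∀ k → Nₖ k ≡ K k * (4 * K k * K k + 3)
modulus-closed = expand
  where
  expand : ∀ k → (suc (suc k * suc (2 * k)) + 2 * suc k) + suc (2 * k) * suc (2 * (suc k * suc k))
                 ≡ suc k * (4 * suc k * suc k + 3)
  expand = solve-∀

modulus-large : ∀ k → 3 * K k * k < Nₖ k
modulus-large k = subst (3 * K k * k <_) (sym (expand k)) (m<m+n (3 * K k * k) (s≤s z≤n))
  where
  expand : ∀ k → (suc (suc k * suc (2 * k)) + 2 * suc k) + suc (2 * k) * suc (2 * (suc k * suc k))
                 ≡ 3 * suc k * k + suc (6 + 12 * k + 9 * k * k + 4 * k * k * k)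
  expand = solve-∀

index<modulus : ∀ k → k < Nₖ k
index<modulus k = ≤-<-trans (m≤n*m k (3 * K k)) (modulus-large k)

crossing : ∀ (f : ℕ → ℕ) X n → f 0 < X → X ≤ f n → ∃ λ p → f p < X × X ≤ f (suc p)
crossing f X zero    f0<X X≤f0 = ⊥-elim (<⇒≱ f0<X X≤f0)
crossing f X (suc n) f0<X X≤fn+1 with f n <? X
... | yes fn<X = n , fn<X , X≤fn+1
... | no  fn≮X = crossing f X n f0<X (≮⇒≥ fn≮X)

sixth-root-bracket : ∀ X → 0 < X → ∃ λ p → p ^ 6 < X × X ≤ suc p ^ 6
sixth-root-bracket X 0<X = crossing (_^ 6) X X 0<X (n≤n^6 X)
  where
  n≤n^6 : ∀ n → n ≤ n ^ 6
  n≤n^6 zero    = z≤n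
  n≤n^6 (suc n) = m≤m*n (suc n) (suc n ^ 5) {{m^n≢0 (suc n) 5}}

pow-mul : ∀ a b n → (a * b) ^ n ≡ a ^ n * b ^ n
pow-mul a b zero    = refl
pow-mul a b (suc n) = begin
  a * b * (a * b) ^ n      ≡⟨ cong (a * b *_) (pow-mul a b n) ⟩
  a * b * (a ^ n * b ^ n)  ≡⟨ interchange a b (a ^ n) (b ^ n) ⟩
  a * a ^ n * (b * b ^ n)  ∎
  where
  open ≡-Reasoning
  interchange : ∀ a b x y → a * b * (x * y) ≡ a * x * (b * y)
  interchange = solve-∀

-- Upper side: if 2^{1/6} ≤ (p + 1)/q and 1/q < e/f, then 2^{1/6} < p/q + e/f.
overshoot : ∀ p q e f → f < e * q → 2 * q ^ 6 ≤ suc p ^ 6 → 2 * (q * f) ^ 6 < (p * f + e * q) ^ 6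
overshoot p q e f f<eq 2q⁶≤[p+1]⁶ = begin-strict
  2 * (q * f) ^ 6      ≡⟨ cong (2 *_) (pow-mul q f 6) ⟩
  2 * (q ^ 6 * f ^ 6)  ≡⟨ *-assoc 2 (q ^ 6) (f ^ 6) ⟨
  2 * q ^ 6 * f ^ 6    ≤⟨ *-monoˡ-≤ (f ^ 6) 2q⁶≤[p+1]⁶ ⟩
  suc p ^ 6 * f ^ 6    ≡⟨ pow-mul (suc p) f 6 ⟨
  (suc p * f) ^ 6      <⟨ ^-monoˡ-< 6 [p+1]f<pf+eq ⟩
  (p * f + e * q) ^ 6  ∎
  where
  open ≤-Reasoning
  [p+1]f<pf+eq : suc p * f < p * f + e * q
  [p+1]f<pf+eq = begin-strict
    f + p * f      ≡⟨ +-comm f (p * f) ⟩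
    p * f + f      <⟨ +-monoʳ-< (p * f) f<eq ⟩
    p * f + e * q  ∎

-- Lower side, first step: if p⁶ < 2q⁶ ≤ k then p⁶N < (2K)³q⁶ (with P = p⁶, Q = q⁶),
-- because 2Q·N = (2K)³Q + 3K·2Q and 3K·2Q ≤ 3Kk < N.
density : ∀ k P Q → suc P ≤ 2 * Q → 2 * Q ≤ k → P * Nₖ k < (2 * K k) ^ 3 * Q
density k P Q P<2Q 2Q≤k = +-cancelʳ-< (Nₖ k) (P * Nₖ k) ((2 * K k) ^ 3 * Q) (begin-strict
  P * Nₖ k + Nₖ k                          ≡⟨ +-comm (P * Nₖ k) (Nₖ k) ⟩
  suc P * Nₖ k                             ≤⟨ *-monoˡ-≤ (Nₖ k) P<2Q ⟩
  2 * Q * Nₖ k                             ≡⟨ cong (2 * Q *_) (modulus-closed k) ⟩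
  2 * Q * (K k * (4 * K k * K k + 3))      ≡⟨ expand Q k ⟩
  (2 * K k) ^ 3 * Q + 3 * K k * (2 * Q)    ≤⟨ +-monoʳ-≤ ((2 * K k) ^ 3 * Q) (*-monoʳ-≤ (3 * K k) 2Q≤k) ⟩
  (2 * K k) ^ 3 * Q + 3 * K k * k          <⟨ +-monoʳ-< ((2 * K k) ^ 3 * Q) (modulus-large k) ⟩
  (2 * K k) ^ 3 * Q + Nₖ k                 ∎)
  where
  open ≤-Reasoning
  expand : ∀ Q k → 2 * Q * (suc k * (4 * suc k * suc k + 3))
                   ≡ (2 * suc k) * ((2 * suc k) * ((2 * suc k) * 1)) * Q + 3 * suc k * (2 * Q)
  expand = solve-∀

cube-bound : ∀ P N Q A D .{{_ : NonZero N}} → P * N < A ^ 3 * Q → A * N ≤ D → P * N ^ 4 < D ^ 3 * Q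
cube-bound P N Q A D PN<A³Q AN≤D = begin-strict
  P * N ^ 4            ≡⟨ *-assoc P N (N ^ 3) ⟨
  P * N * N ^ 3        <⟨ *-monoˡ-< (N ^ 3) {{m^n≢0 N 3}} PN<A³Q ⟩
  A ^ 3 * Q * N ^ 3    ≡⟨ regroup A Q N ⟩
  (A * N) ^ 3 * Q      ≤⟨ *-monoˡ-≤ Q (^-monoˡ-≤ 3 AN≤D) ⟩
  D ^ 3 * Q            ∎
  where
  open ≤-Reasoning
  regroup : ∀ a q n → a * (a * (a * 1)) * q * (n * (n * (n * 1)))
                      ≡ (a * n) * ((a * n) * ((a * n) * 1)) * q
  regroup = solve-∀

fresh : ∀ (L : List (ℕ × ℕ × ℕ × ℕ)) N r → sum (map proj₁ L) < N → (N , r) ∉ L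
fresh L N r sum<N N∈L = <⇒≱ sum<N (bounded L N∈L)
  where
  bounded : ∀ L → (N , r) ∈ L → N ≤ sum (map proj₁ L)
  bounded ((M , _) ∷ L) (here refl) = m≤m+n M (sum (map proj₁ L))
  bounded ((M , _) ∷ L) (there N∈L) = ≤-trans (bounded L N∈L) (m≤n+m (sum (map proj₁ L)) M)

theorem1 : (e f : ℕ) → 0 < e → 0 < f → (L : List (ℕ × ℕ × ℕ × ℕ)) →
    ∃ λ N → ∃ λ a → ∃ λ b → ∃ λ c →
      (N , a , b , c) ∉ L × 0 < a × a < b × b < c × c < N × gcd N a ≡ 1 ×
      ∃ λ D → shortestSq N a b c ≡ just D ×
        ∃ λ p → ∃ λ q → 0 < q ×
          p ^ 6 * N ^ 4 < D ^ 3 * q ^ 6 ×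
          2 * (q * f) ^ 6 < (p * f + e * q) ^ 6
theorem1 e f 0<e _ L =
  let -- denominator q = f + 1, so that 1/q < e/f
      q = suc f
      f<eq : f < e * q
      f<eq = m≤n*m q e {{>-nonZero 0<e}}
      (p , p⁶<2q⁶ , 2q⁶≤[p+1]⁶) = sixth-root-bracket (2 * q ^ 6) (s≤s z≤n)
      -- a member of the family large enough for the approximation and outside L
      moduli = sum (map proj₁ L)
      k = 2 * q ^ 6 + moduli
      N = Nₖ k
      (D , shortest≡D , 2KN≤D) = family-shortest k
      moduli<N : moduli < N
      moduli<N = ≤-<-trans (m≤n+m moduli (2 * q ^ 6)) (index<modulus k)
      below : p ^ 6 * N ^ 4 < D ^ 3 * q ^ 6
      below = cube-bound (p ^ 6) N (q ^ 6) (2 * K k) D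
                (density k (p ^ 6) (q ^ 6) p⁶<2q⁶ (m≤m+n (2 * q ^ 6) moduli)) 2KN≤D
  in N , 1 , bₖ k , cₖ k ,
     fresh L N (1 , bₖ k , cₖ k) moduli<N , s≤s z≤n , s≤s (s≤s z≤n) ,
     m<m+n (bₖ k) (s≤s z≤n) , m<m+n (cₖ k) (s≤s z≤n) , gcd-zeroʳ N ,
     D , shortest≡D , p , q , s≤s z≤n , below , overshoot p q e f f<eq 2q⁶≤[p+1]⁶
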